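{- For every computation $M$ of $\lambda_{\copyright}$, the following are equivalent: (1) $M$ is $\to_{\copyright}$-normalizing; (2) $M$ is $\to_{\sigma\beta_c}$-normalizing.
   Context: The computational core $\lambda_{\copyright}$ has values $V,W ::= x \mid \lambda x.M$ and computations $M,N,L ::= \,!V \mid VM$ ($x$ ranging over a countable set of variables, terms up to $\alpha$-renaming). Rules: $\beta_c$: $(\lambda x.M)(!V) \mapsto M\{V/x\}$; $\mathsf{id}$: $(\lambda x.!x)M \mapsto M$; $\sigma$: $(\lambda y.N)((\lambda x.M)L) \mapsto (\lambda x.(\lambda y.N)M)L$ provided $x\notin \mathrm{fv}(N)$; $\sigma\beta_c=\sigma\cup\beta_c$, $\copyright=\beta_c\cup\mathsf{id}\cup\sigma$. Contexts: $C ::= [\,] \mid\, !(\lambda x.C) \mid VC \mid (\lambda x.C)M$; $\to_\rho$ is the closure of rule $\rho$ under contexts. A term $M$ is $\to$-normalizing (weakly normalizing) if there is a $\to$-sequence from $M$ ending in a $\to$-normal form (a term with no $\to$-step). -}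

module Defs where

open import Data.Nat using (ℕ; zero; suc)
open import Data.Fin using (Fin; zero; suc)
open import Data.Product using (Σ; _×_; _,_; ∃)
open import Data.Sum using (_⊎_)
open import Relation.Nullary using (¬_)
open import Relation.Binary.Construct.Closure.ReflexiveTransitive using (Star)

-- Well-scoped de Bruijn syntax of the computational core λ©
-- (terms up to α-renaming).  n = number of free variables in scope.
mutual
  data Val (n : ℕ) : Set where
    var : Fin n → Val n
    lam : Comp (suc n) → Val n

  data Comp (n : ℕ) : Set where
    ret : Val n → Comp n              -- !V
    app : Val n → Comp n → Comp n

Ren : ℕ → ℕ → Set
Ren m n = Fin m → Fin n

ext : ∀ {m n} → Ren m n → Ren (suc m) (suc n)
ext ρ zero    = zero
ext ρ (suc i) = suc (ρ i)

mutual
  renV : ∀ {m n} → Ren m n → Val m → Val n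
  renV ρ (var i) = var (ρ i)
  renV ρ (lam M) = lam (renC (ext ρ) M)

  renC : ∀ {m n} → Ren m n → Comp m → Comp n
  renC ρ (ret V)   = ret (renV ρ V)
  renC ρ (app V M) = app (renV ρ V) (renC ρ M)

Sub : ℕ → ℕ → Set
Sub m n = Fin m → Val n

exts : ∀ {m n} → Sub m n → Sub (suc m) (suc n)
exts σ zero    = var zero
exts σ (suc i) = renV suc (σ i)

mutual
  subV : ∀ {m n} → Sub m n → Val m → Val n
  subV σ (var i) = σ i
  subV σ (lam M) = lam (subC (exts σ) M)

  subC : ∀ {m n} → Sub m n → Comp m → Comp n
  subC σ (ret V)   = ret (subV σ V)
  subC σ (app V M) = app (subV σ V) (subC σ M)

sub1 : ∀ {n} → Val n → Sub (suc n) n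
sub1 V zero    = V
sub1 V (suc i) = var i

_[_] : ∀ {n} → Comp (suc n) → Val n → Comp n
M [ V ] = subC (sub1 V) M

-- weakening of N (scope y,…) past a fresh variable x inserted under y:
-- this realises the side condition x ∉ fv(N) of rule σ.
weak1 : ∀ {n} → Comp (suc n) → Comp (suc (suc n))
weak1 = renC (ext suc)

Rule : Set₁
Rule = ∀ {n} → Comp n → Comp n → Set

data βc : Rule where
  βc-rule : ∀ {n} (M : Comp (suc n)) (V : Val n) →
            βc (app (lam M) (ret V)) (M [ V ])

data idr : Rule where
  id-rule : ∀ {n} (M : Comp n) → idr (app (lam (ret (var zero))) M) M

-- σ : (λy.N)((λx.M)L) ↦ (λx.(λy.N)M)L    (x ∉ fv(N))
data σr : Rule where
  σ-rule : ∀ {n} (N : Comp (suc n)) (M : Comp (suc n)) (L : Comp n) →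
           σr (app (lam N) (app (lam M) L))
              (app (lam (app (lam (weak1 N)) M)) L)

_∪_ : Rule → Rule → Rule
(r ∪ s) M N = r M N ⊎ s M N

σβc : Rule
σβc = σr ∪ βc

copy : Rule
copy = βc ∪ (idr ∪ σr)

data Step (r : Rule) : Rule where
  root : ∀ {n} {M N : Comp n} → r M N → Step r M N
  bang : ∀ {n} {M N : Comp (suc n)} → Step r M N →
         Step r (ret (lam M)) (ret (lam N))
  argC : ∀ {n} (V : Val n) {M N : Comp n} → Step r M N →
         Step r (app V M) (app V N)
  funC : ∀ {n} {M N : Comp (suc n)} (L : Comp n) → Step r M N →
         Step r (app (lam M) L) (app (lam N) L)

Normal : Rule → ∀ {n} → Comp n → Set
Normal R M = ∀ N → ¬ R M N

Normalizing : Rule → ∀ {n} → Comp n → Set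
Normalizing R M = ∃ λ N → Star R M N × Normal R N

-- Every σβc-step is a ©-step, and an id-step only deletes an identity I = λx.!x applied to
-- a computation.  Call M an I-expansion of N if M is N with identities inserted in front
-- of subcomputations.  I-expansion is a backward simulation for σβc: a βc- or σ-redex of N
-- reappears in M once the identities in front of its argument are consumed, which βc does
-- for I(!W) and σ followed by βc does for (λy.Q)(I R).  Moreover every I-expansion of a
-- σβc-normal form σβc-normalizes.  Hence if M ©-reduces to a ©-normal form, M
-- σβc-normalizes, by induction along the reduction.  Conversely, a σβc-normal form has no
-- βc- or σ-redex, and contracting its id-redexes creates none, so it ©-normalizes.
module Submission where

open import Defs
open import Data.Nat using (ℕ; zero; suc)
open import Data.Fin using (Fin; zero; suc)
open import Data.Product using (_×_; _,_; ∃; ∃₂)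
open import Data.Sum using (_⊎_; inj₁; inj₂)
open import Data.Empty using (⊥-elim)
open import Relation.Nullary using (¬_)
open import Relation.Binary.PropositionalEquality using (_≡_; _≢_; refl; trans; cong; cong₂; subst)
open import Relation.Binary.Construct.Closure.ReflexiveTransitive using (Star; ε; _◅_; _◅◅_; gmap) renaming (map to Star-map)

private variable
  l m n : ℕ
  r s : Rule
  j : Fin n
  V V′ W W′ : Val n
  M M′ N N′ L : Comp n
  P P′ Q : Comp (suc n)

I : Val n
I = lam (ret (var zero))

underI : ℕ → Comp n → Comp n
underI zero    M = M
underI (suc k) M = app I (underI k M)

_⟶σβc*_ : Comp n → Comp n → Set
_⟶σβc*_ = Star (Step σβc)

Step-mono : (∀ {n} {M N : Comp n} → r M N → s M N) → Step r M N → Step s M N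
Step-mono r⊆s (root x)   = root (r⊆s x)
Step-mono r⊆s (bang x)   = bang (Step-mono r⊆s x)
Step-mono r⊆s (argC V x) = argC V (Step-mono r⊆s x)
Step-mono r⊆s (funC L x) = funC L (Step-mono r⊆s x)

σβc⊆copy : σβc M N → copy M N
σβc⊆copy (inj₁ σ)  = inj₂ (inj₂ σ)
σβc⊆copy (inj₂ βc) = inj₁ βc

argC* : (V : Val n) → Star (Step r) M N → Star (Step r) (app V M) (app V N)
argC* V = gmap (app V) (argC V)

funC* : (L : Comp n) → Star (Step r) P Q → Star (Step r) (app (lam P) L) (app (lam Q) L)
funC* L = gmap (λ P → app (lam P) L) (funC L)

bang* : Star (Step r) P Q → Star (Step r) (ret (lam P)) (ret (lam Q))
bang* = gmap (λ P → ret (lam P)) bang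

normal-bang : Normal (Step r) (ret (lam P)) → Normal (Step r) P
normal-bang nf _ x = nf _ (bang x)

normal-arg : Normal (Step r) (app V M) → Normal (Step r) M
normal-arg nf _ x = nf _ (argC _ x)

normal-fun : Normal (Step r) (app (lam P) L) → Normal (Step r) P
normal-fun nf _ x = nf _ (funC _ x)

normal-underI : ∀ k → Normal (Step r) (underI k M) → Normal (Step r) M
normal-underI zero    nf = nf
normal-underI (suc k) nf = normal-underI k (normal-arg nf)

data LamApp {n} : Comp n → Set where
  lamApp : (P : Comp (suc n)) (L : Comp n) → LamApp (app (lam P) L)

module Normality (r-lamApp : ∀ {n} {M N : Comp n} → r M N → LamApp M) where

  ret-var-normal : (i : Fin n) → Normal (Step r) (ret (var i))
  ret-var-normal i _ (root x) with r-lamApp x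
  ... | ()

  ret-lam-normal : Normal (Step r) P → Normal (Step r) (ret (lam P))
  ret-lam-normal nP _ (root x) with r-lamApp x
  ... | ()
  ret-lam-normal nP _ (bang x) = nP _ x

  app-var-normal : (i : Fin n) → Normal (Step r) M → Normal (Step r) (app (var i) M)
  app-var-normal i nM _ (root x) with r-lamApp x
  ... | ()
  app-var-normal i nM _ (argC _ x) = nM _ x

  lam-app-var-normal : (∀ N → ¬ r (app (lam P) (app (var j) L)) N) →
    Normal (Step r) P → Normal (Step r) L → Normal (Step r) (app (lam P) (app (var j) L))
  lam-app-var-normal noRoot nP nL _ (root x)                = noRoot _ x
  lam-app-var-normal noRoot nP nL _ (funC _ x)              = nP _ x
  lam-app-var-normal noRoot nP nL _ (argC _ (argC _ x))     = nL _ x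
  lam-app-var-normal noRoot nP nL _ (argC _ (root x)) with r-lamApp x
  ... | ()

σβc-lamApp : σβc M N → LamApp M
σβc-lamApp (inj₁ (σ-rule N M L)) = lamApp N _
σβc-lamApp (inj₂ (βc-rule M V))  = lamApp M _

copy-lamApp : copy M N → LamApp M
copy-lamApp (inj₁ (βc-rule M V))         = lamApp M _
copy-lamApp (inj₂ (inj₁ (id-rule M)))    = lamApp _ M
copy-lamApp (inj₂ (inj₂ (σ-rule N M L))) = lamApp N _

module σβc-Normality = Normality {r = σβc} σβc-lamApp
module copy-Normality = Normality {r = copy} copy-lamApp

σβc-normal-lam-app : Normal (Step σβc) (app (lam P) M) → ∃₂ λ j L → M ≡ app (var j) L
σβc-normal-lam-app {P = P} {M = ret V}             nf = ⊥-elim (nf _ (root (inj₂ (βc-rule P V))))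
σβc-normal-lam-app {P = P} {M = app (lam Q) L}     nf = ⊥-elim (nf _ (root (inj₁ (σ-rule P Q L))))
σβc-normal-lam-app         {M = app (var j) L}     nf = j , L , refl

no-σβc-root : ∀ N → ¬ σβc (app (lam P) (app (var j) L)) N
no-σβc-root _ (inj₁ ())
no-σβc-root _ (inj₂ ())

mutual
  subC-renC : (σ : Sub m n) (ρ : Ren l m) (τ : Sub l n) → (∀ i → σ (ρ i) ≡ τ i) →
    ∀ M → subC σ (renC ρ M) ≡ subC τ M
  subC-renC σ ρ τ eq (ret V)   = cong ret (subV-renV σ ρ τ eq V)
  subC-renC σ ρ τ eq (app V M) = cong₂ app (subV-renV σ ρ τ eq V) (subC-renC σ ρ τ eq M)

  subV-renV : (σ : Sub m n) (ρ : Ren l m) (τ : Sub l n) → (∀ i → σ (ρ i) ≡ τ i) →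
    ∀ V → subV σ (renV ρ V) ≡ subV τ V
  subV-renV σ ρ τ eq (var i) = eq i
  subV-renV σ ρ τ eq (lam M) = cong lam (subC-renC (exts σ) (ext ρ) (exts τ) eq′ M)
    where
    eq′ : ∀ i → exts σ (ext ρ i) ≡ exts τ i
    eq′ zero    = refl
    eq′ (suc i) = cong (renV suc) (eq i)

mutual
  subC-id : (σ : Sub n n) → (∀ i → σ i ≡ var i) → ∀ M → subC σ M ≡ M
  subC-id σ eq (ret V)   = cong ret (subV-id σ eq V)
  subC-id σ eq (app V M) = cong₂ app (subV-id σ eq V) (subC-id σ eq M)

  subV-id : (σ : Sub n n) → (∀ i → σ i ≡ var i) → ∀ V → subV σ V ≡ V
  subV-id σ eq (var i) = eq i
  subV-id σ eq (lam M) = cong lam (subC-id (exts σ) eq′ M)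
    where
    eq′ : ∀ i → exts σ i ≡ var i
    eq′ zero    = refl
    eq′ (suc i) = cong (renV suc) (eq i)

weak1-[var0] : (Q : Comp (suc n)) → weak1 Q [ var zero ] ≡ Q
weak1-[var0] Q = trans (subC-renC (sub1 (var zero)) (ext suc) var eq Q) (subC-id var (λ _ → refl) Q)
  where
  eq : ∀ i → sub1 (var zero) (ext suc i) ≡ var i
  eq zero    = refl
  eq (suc i) = refl

absorb-I : (Q : Comp (suc n)) (R : Comp n) → app (lam Q) (app I R) ⟶σβc* app (lam Q) R
absorb-I Q R =
  root (inj₁ (σ-rule Q (ret (var zero)) R)) ◅
  subst (λ Q′ → Step σβc (app (lam (app (lam (weak1 Q)) (ret (var zero)))) R) (app (lam Q′) R))
        (weak1-[var0] Q) (funC R (root (inj₂ (βc-rule (weak1 Q) (var zero))))) ◅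
  ε

absorb-underI : ∀ k (Q : Comp (suc n)) (R : Comp n) → app (lam Q) (underI k R) ⟶σβc* app (lam Q) R
absorb-underI zero    Q R = ε
absorb-underI (suc k) Q R = absorb-I Q (underI k R) ◅◅ absorb-underI k Q R

underI-ret : ∀ k (W : Val n) → underI k (ret W) ⟶σβc* ret W
underI-ret zero    W = ε
underI-ret (suc k) W = argC* I (underI-ret k W) ◅◅ root (inj₂ (βc-rule (ret (var zero)) W)) ◅ ε

-- M ⊒ N : M is an I-expansion of N.
infix 4 _⊒_ _⊒ᵛ_

data _⊒ᵛ_ : Val n → Val n → Set
data _⊒_ : Comp n → Comp n → Set

data _⊒ᵛ_ where
  ⊒-var : (i : Fin n) → var i ⊒ᵛ var i
  ⊒-lam : P′ ⊒ P → lam P′ ⊒ᵛ lam P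

data _⊒_ where
  ⊒-I   : M ⊒ N → app I M ⊒ N
  ⊒-ret : V′ ⊒ᵛ V → ret V′ ⊒ ret V
  ⊒-app : V′ ⊒ᵛ V → M′ ⊒ M → app V′ M′ ⊒ app V M

mutual
  ⊒-refl : (M : Comp n) → M ⊒ M
  ⊒-refl (ret V)   = ⊒-ret (⊒ᵛ-refl V)
  ⊒-refl (app V M) = ⊒-app (⊒ᵛ-refl V) (⊒-refl M)

  ⊒ᵛ-refl : (V : Val n) → V ⊒ᵛ V
  ⊒ᵛ-refl (var i) = ⊒-var i
  ⊒ᵛ-refl (lam M) = ⊒-lam (⊒-refl M)

mutual
  ⊒-renC : (ρ : Ren m n) → M ⊒ N → renC ρ M ⊒ renC ρ N
  ⊒-renC ρ (⊒-I e)     = ⊒-I (⊒-renC ρ e)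
  ⊒-renC ρ (⊒-ret v)   = ⊒-ret (⊒-renV ρ v)
  ⊒-renC ρ (⊒-app v e) = ⊒-app (⊒-renV ρ v) (⊒-renC ρ e)

  ⊒-renV : (ρ : Ren m n) → V ⊒ᵛ W → renV ρ V ⊒ᵛ renV ρ W
  ⊒-renV ρ (⊒-var i) = ⊒-var (ρ i)
  ⊒-renV ρ (⊒-lam e) = ⊒-lam (⊒-renC (ext ρ) e)

mutual
  ⊒-subC : (σ′ σ : Sub m n) → (∀ i → σ′ i ⊒ᵛ σ i) → M ⊒ N → subC σ′ M ⊒ subC σ N
  ⊒-subC σ′ σ h (⊒-I e)     = ⊒-I (⊒-subC σ′ σ h e)
  ⊒-subC σ′ σ h (⊒-ret v)   = ⊒-ret (⊒-subV σ′ σ h v)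
  ⊒-subC σ′ σ h (⊒-app v e) = ⊒-app (⊒-subV σ′ σ h v) (⊒-subC σ′ σ h e)

  ⊒-subV : (σ′ σ : Sub m n) → (∀ i → σ′ i ⊒ᵛ σ i) → V ⊒ᵛ W → subV σ′ V ⊒ᵛ subV σ W
  ⊒-subV σ′ σ h (⊒-var i) = h i
  ⊒-subV σ′ σ h (⊒-lam e) = ⊒-lam (⊒-subC (exts σ′) (exts σ) h′ e)
    where
    h′ : ∀ i → exts σ′ i ⊒ᵛ exts σ i
    h′ zero    = ⊒-var zero
    h′ (suc i) = ⊒-renV suc (h i)

⊒-[] : P′ ⊒ P → W′ ⊒ᵛ W → P′ [ W′ ] ⊒ P [ W ]
⊒-[] {W′ = W′} {W} e v = ⊒-subC (sub1 W′) (sub1 W) h e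
  where
  h : ∀ i → sub1 W′ i ⊒ᵛ sub1 W i
  h zero    = v
  h (suc i) = ⊒-var i

⊒-ret-inv : M ⊒ ret W → ∃₂ λ k W′ → M ≡ underI k (ret W′) × W′ ⊒ᵛ W
⊒-ret-inv (⊒-I e) with ⊒-ret-inv e
... | k , W′ , refl , v = suc k , W′ , refl , v
⊒-ret-inv (⊒-ret v) = zero , _ , refl , v

⊒-app-inv : M ⊒ app V L → ∃₂ λ k V′ → ∃ λ L′ → M ≡ underI k (app V′ L′) × V′ ⊒ᵛ V × L′ ⊒ L
⊒-app-inv (⊒-I e) with ⊒-app-inv e
... | k , V′ , L′ , refl , v , e′ = suc k , V′ , L′ , refl , v , e′
⊒-app-inv (⊒-app v e) = zero , _ , _ , refl , v , e

open σβc-Normality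

normalize-I-app : Normal (Step σβc) M → M ⊒ N →
  ∃ λ M′ → app I M ⟶σβc* M′ × Normal (Step σβc) M′ × M′ ⊒ N
normalize-I-app nM (⊒-ret {V′ = V} v) =
  ret V , root (inj₂ (βc-rule (ret (var zero)) V)) ◅ ε , nM , ⊒-ret v
-- I (x L) has no σβc-redex, so the identity stays.
normalize-I-app nM (⊒-app (⊒-var i) e) =
  _ , ε ,
  lam-app-var-normal no-σβc-root (ret-var-normal zero) (normal-arg nM) ,
  ⊒-I (⊒-app (⊒-var i) e)
normalize-I-app nM (⊒-I e) with σβc-normal-lam-app nM
... | j , L , refl = _ , absorb-I (ret (var zero)) (app (var j) L) , nM , ⊒-I e
-- I((λx.P)(y L)) σ-reduces to (λx.I P)(y L).
normalize-I-app nM (⊒-app {M′ = X} (⊒-lam {P′ = P} eP) eX) with σβc-normal-lam-app nM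
... | j , L , refl with normalize-I-app (normal-fun nM) eP
... | P′ , rP , nP′ , eP′ =
  app (lam P′) X ,
  root (inj₁ (σ-rule (ret (var zero)) P X)) ◅ funC* X rP ,
  lam-app-var-normal no-σβc-root nP′ (normal-arg (normal-arg nM)) , ⊒-app (⊒-lam eP′) eX

normalize-expansion : M ⊒ N → Normal (Step σβc) N →
  ∃ λ M′ → M ⟶σβc* M′ × Normal (Step σβc) M′ × M′ ⊒ N
normalize-expansion (⊒-I e) nN with normalize-expansion e nN
... | M′ , r , nM′ , e′ with normalize-I-app nM′ e′
... | M″ , r′ , nM″ , e″ = M″ , argC* I r ◅◅ r′ , nM″ , e″
normalize-expansion (⊒-ret (⊒-var i)) nN = _ , ε , ret-var-normal i , ⊒-ret (⊒-var i)
normalize-expansion (⊒-ret (⊒-lam e)) nN with normalize-expansion e (normal-bang nN)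
... | P′ , r , nP′ , e′ = ret (lam P′) , bang* r , ret-lam-normal nP′ , ⊒-ret (⊒-lam e′)
normalize-expansion (⊒-app (⊒-var i) e) nN with normalize-expansion e (normal-arg nN)
... | M′ , r , nM′ , e′ = app (var i) M′ , argC* (var i) r , app-var-normal i nM′ , ⊒-app (⊒-var i) e′
normalize-expansion (⊒-app (⊒-lam eP) e) nN with σβc-normal-lam-app nN
... | j , L , refl
  with normalize-expansion eP (normal-fun nN) | normalize-expansion e (normal-arg nN)
... | P′ , rP , nP′ , eP′ | X′ , rX , nX′ , eX′ with ⊒-app-inv eX′
... | k , var j , L′ , refl , ⊒-var j , eL′ =
  app (lam P′) (app (var j) L′) ,
  funC* _ rP ◅◅ argC* (lam P′) rX ◅◅ absorb-underI k P′ (app (var j) L′) ,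
  lam-app-var-normal no-σβc-root nP′ (normal-arg (normal-underI k nX′)) ,
  ⊒-app (⊒-lam eP′) (⊒-app (⊒-var j) eL′)

⊒-simulates-σβc : M ⊒ N → Step σβc N N′ → ∃ λ M′ → M ⟶σβc* M′ × M′ ⊒ N′
⊒-simulates-σβc (⊒-I e) x with ⊒-simulates-σβc e x
... | M′ , r , e′ = app I M′ , argC* I r , ⊒-I e′
⊒-simulates-σβc (⊒-ret v) (root x) with σβc-lamApp x
... | ()
⊒-simulates-σβc (⊒-ret (⊒-lam e)) (bang x) with ⊒-simulates-σβc e x
... | P′ , r , e′ = ret (lam P′) , bang* r , ⊒-ret (⊒-lam e′)
⊒-simulates-σβc (⊒-app v e) (argC _ x) with ⊒-simulates-σβc e x
... | M′ , r , e′ = app _ M′ , argC* _ r , ⊒-app v e′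
⊒-simulates-σβc (⊒-app (⊒-lam eP) e) (funC _ x) with ⊒-simulates-σβc eP x
... | P′ , r , e′ = app (lam P′) _ , funC* _ r , ⊒-app (⊒-lam e′) e
⊒-simulates-σβc (⊒-app {V′ = lam P′} (⊒-lam eP) e) (root (inj₂ (βc-rule P W))) with ⊒-ret-inv e
... | k , W′ , refl , v =
  P′ [ W′ ] , argC* _ (underI-ret k W′) ◅◅ root (inj₂ (βc-rule P′ W′)) ◅ ε , ⊒-[] eP v
⊒-simulates-σβc (⊒-app {V′ = lam Q′} (⊒-lam eQ) e) (root (inj₁ (σ-rule Q P L))) with ⊒-app-inv e
... | k , lam P′ , L′ , refl , ⊒-lam eP , eL =
  app (lam (app (lam (weak1 Q′)) P′)) L′ ,
  absorb-underI k Q′ (app (lam P′) L′) ◅◅ root (inj₁ (σ-rule Q′ P′ L′)) ◅ ε ,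
  ⊒-app (⊒-lam (⊒-app (⊒-lam (⊒-renC (ext suc) eQ)) eP)) eL

⊒-normalizing : N ⟶σβc* L → Normal (Step σβc) L → M ⊒ N → Normalizing (Step σβc) M
⊒-normalizing ε nL e with normalize-expansion e nL
... | M′ , r , nM′ , _ = M′ , r , nM′
⊒-normalizing (x ◅ xs) nL e with ⊒-simulates-σβc e x
... | M′ , r , e′ with ⊒-normalizing xs nL e′
... | L′ , r′ , nL′ = L′ , r ◅◅ r′ , nL′

copy-step-split : Step copy M N → Step σβc M N ⊎ M ⊒ N
copy-step-split (root (inj₁ βc))              = inj₁ (root (inj₂ βc))
copy-step-split (root (inj₂ (inj₁ (id-rule M)))) = inj₂ (⊒-I (⊒-refl M))
copy-step-split (root (inj₂ (inj₂ σ)))        = inj₁ (root (inj₁ σ))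
copy-step-split (bang x) with copy-step-split x
... | inj₁ x′ = inj₁ (bang x′)
... | inj₂ e  = inj₂ (⊒-ret (⊒-lam e))
copy-step-split (argC V x) with copy-step-split x
... | inj₁ x′ = inj₁ (argC V x′)
... | inj₂ e  = inj₂ (⊒-app (⊒ᵛ-refl V) e)
copy-step-split (funC L x) with copy-step-split x
... | inj₁ x′ = inj₁ (funC L x′)
... | inj₂ e  = inj₂ (⊒-app (⊒-lam e) (⊒-refl L))

copy-normal⇒σβc-normal : Normal (Step copy) M → Normal (Step σβc) M
copy-normal⇒σβc-normal nM _ x = nM _ (Step-mono σβc⊆copy x)

copy-reduct-normalizing : Star (Step copy) M N → Normal (Step copy) N → Normalizing (Step σβc) M
copy-reduct-normalizing ε nN = _ , ε , copy-normal⇒σβc-normal nN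
copy-reduct-normalizing (x ◅ xs) nN with copy-reduct-normalizing xs nN | copy-step-split x
... | L , r , nL | inj₁ x′ = L , x′ ◅ r , nL
... | L , r , nL | inj₂ e  = ⊒-normalizing r nL e

copy-normal-lam-app-var : P ≢ ret (var zero) → Normal (Step copy) P → Normal (Step copy) L →
  Normal (Step copy) (app (lam P) (app (var j) L))
copy-normal-lam-app-var P≢I = copy-Normality.lam-app-var-normal noRoot
  where
  noRoot : ∀ N → ¬ copy (app (lam _) (app (var _) _)) N
  noRoot _ (inj₁ ())
  noRoot _ (inj₂ (inj₁ (id-rule _))) = P≢I refl
  noRoot _ (inj₂ (inj₂ ()))

normalize-lam-app-var : (P : Comp (suc n)) (j : Fin n) (L : Comp n) →
  Normal (Step copy) P → Normal (Step copy) L → Normalizing (Step copy) (app (lam P) (app (var j) L))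
normalize-lam-app-var (ret (var zero)) j L nP nL =
  app (var j) L , root (inj₂ (inj₁ (id-rule _))) ◅ ε , copy-Normality.app-var-normal j nL
normalize-lam-app-var (ret (var (suc i))) j L nP nL = _ , ε , copy-normal-lam-app-var (λ ()) nP nL
normalize-lam-app-var (ret (lam Q)) j L nP nL       = _ , ε , copy-normal-lam-app-var (λ ()) nP nL
normalize-lam-app-var (app V K) j L nP nL           = _ , ε , copy-normal-lam-app-var (λ ()) nP nL

σβc-normal⇒copy-normalizing : Normal (Step σβc) M → Normalizing (Step copy) M
σβc-normal⇒copy-normalizing {M = ret (var i)} nM = _ , ε , copy-Normality.ret-var-normal i
σβc-normal⇒copy-normalizing {M = ret (lam P)} nM with σβc-normal⇒copy-normalizing (normal-bang nM)
... | P′ , r , nP′ = ret (lam P′) , bang* r , copy-Normality.ret-lam-normal nP′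
σβc-normal⇒copy-normalizing {M = app (var i) M} nM with σβc-normal⇒copy-normalizing (normal-arg nM)
... | M′ , r , nM′ = app (var i) M′ , argC* _ r , copy-Normality.app-var-normal i nM′
σβc-normal⇒copy-normalizing {M = app (lam P) M} nM with σβc-normal-lam-app nM
... | j , L , refl
  with σβc-normal⇒copy-normalizing (normal-fun nM) | σβc-normal⇒copy-normalizing (normal-arg (normal-arg nM))
... | P′ , rP , nP′ | L′ , rL , nL′ with normalize-lam-app-var P′ j L′ nP′ nL′
... | F , rF , nF = F , funC* _ rP ◅◅ argC* _ (argC* _ rL) ◅◅ rF , nF

copy-normalizing⇒σβc-normalizing : Normalizing (Step copy) M → Normalizing (Step σβc) M
copy-normalizing⇒σβc-normalizing (N , r , nN) = copy-reduct-normalizing r nN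

σβc-normalizing⇒copy-normalizing : Normalizing (Step σβc) M → Normalizing (Step copy) M
σβc-normalizing⇒copy-normalizing (N , r , nN) with σβc-normal⇒copy-normalizing nN
... | F , r′ , nF = F , Star-map (Step-mono σβc⊆copy) r ◅◅ r′ , nF

mainTheorem6 : ∀ {n : ℕ} (M : Comp n) →
    (Normalizing (Step copy) M → Normalizing (Step σβc) M) ×
    (Normalizing (Step σβc) M → Normalizing (Step copy) M)
mainTheorem6 M = copy-normalizing⇒σβc-normalizing , σβc-normalizing⇒copy-normalizing
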